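{- If $k>1$ is an odd integer, then at least one of the numbers $k$, $L_2(k)$, $L_2^{(2)}(k)$ is divisible by $3$.
   Context: For $n\in\mathbb{N}$, $L_2(n)$ is the number of integers $j\in\{1,\dots,n\}$ with $\gcd(j,n)=\gcd(j+1,n)=1$; by convention $L_2(0)=0$. Equivalently, $L_2(1)=1$, and for $n>1$ with $n=\prod_{i=1}^r p_i^{\alpha_i}$, $L_2(n)=0$ if $n$ has a prime factor $\le 2$, and $L_2(n)=\prod_i p_i^{\alpha_i-1}(p_i-2)$ otherwise. $L_2^{(2)}=L_2\circ L_2$. Note $0$ is divisible by $3$. -}

module Defs where

open import Data.Nat using (ℕ; suc; _+_)
open import Data.Nat.GCD using (gcd)
open import Data.Nat.Coprimality using (Coprime; coprime?)
open import Data.List using (List; length; filter; map; upTo)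
open import Relation.Nullary.Decidable using (_×-dec_)

L₂ : ℕ → ℕ
L₂ n = length (filter (λ j → coprime? j n ×-dec coprime? (suc j) n)
                      (map suc (upTo n)))

L₂² : ℕ → ℕ
L₂² n = L₂ (L₂ n)

{-# OPTIONS --safe #-}
module Submission where

-- For a prime p, the residues modulo p·m split as t·m + r with t < p and r < m,
-- and j is counted by L₂ (p·m) exactly when r is counted by L₂ m and p divides neither
-- j nor j + 1. If p ∤ m then for each r exactly two of the p values of t are excluded,
-- so L₂ (p·m) = (p - 2)·L₂ m; if p ∣ m nothing is excluded and L₂ (p·m) = p·L₂ m.
-- Hence p ∣ n implies p - 2 ∣ L₂ n. If 3 ∤ k, take a prime p ∣ k: either p ≡ 2 (mod 3)
-- and 3 ∣ p - 2 ∣ L₂ k, or p ≡ 1 (mod 3), so p - 2 ≡ 2 (mod 3) has a prime factor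
-- q ≡ 2 (mod 3), and then 3 ∣ q - 2 ∣ L₂ (L₂ k) because q ∣ p - 2 ∣ L₂ k.

open import Defs
open import Data.Bool using (Bool; true; false; _∧_)
open import Data.List using (length; filter; applyUpTo; []; _∷_)
open import Data.List.Properties using (map-upTo)
open import Data.List.Relation.Unary.All using (_∷_)
open import Data.Nat
open import Data.Nat.Properties
open import Algebra.Properties.CommutativeSemigroup +-commutativeSemigroup using (interchange)
open import Data.Nat.Divisibility
open import Data.Nat.DivMod
open import Data.Nat.GCD using (module Bézout)
open import Data.Nat.Coprimality using (Coprime; coprime?; coprime-divisor; coprime-Bézout)
open import Data.Nat.Induction using (<-rec)
open import Data.Nat.ListAction using (product)
open import Data.Nat.Primality
open import Data.Nat.Primality.Factorisation using (factorise)
open import Data.Nat.Tactic.RingSolver using (solve-∀)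
open import Data.Product using (∃-syntax; _×_; _,_)
open import Data.Sum as Sum using (_⊎_; inj₁; inj₂)
open import Function using (_∘_; case_of_; _⇔_; mk⇔; Equivalence)
open import Relation.Nullary using (¬_; Dec; yes; no; does; contradiction)
open import Relation.Nullary.Decidable using (_×-dec_; ¬?; does-⇔; dec-true; dec-false)
open import Relation.Unary using (Pred; Decidable)
open import Relation.Binary.PropositionalEquality

open Equivalence using (to; from)
open ≡-Reasoning

∑ : ℕ → (ℕ → ℕ) → ℕ
∑ zero    f = 0
∑ (suc n) f = ∑ n f + f n

syntax ∑ n (λ i → e) = ∑[ i < n ] e

∑-cong : ∀ n {f g : ℕ → ℕ} → (∀ {i} → i < n → f i ≡ g i) → ∑ n f ≡ ∑ n g
∑-cong zero    f≗g = refl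
∑-cong (suc n) f≗g = cong₂ _+_ (∑-cong n (f≗g ∘ m<n⇒m<1+n)) (f≗g ≤-refl)

∑-const : ∀ n c → ∑[ i < n ] c ≡ n * c
∑-const zero    c = refl
∑-const (suc n) c rewrite ∑-const n c = +-comm (n * c) c

∑-sucˡ : ∀ n f → ∑ (suc n) f ≡ f 0 + ∑[ i < n ] f (suc i)
∑-sucˡ zero    f = +-comm 0 (f 0)
∑-sucˡ (suc n) f = begin
  ∑ (suc n) f + f (suc n)                ≡⟨ cong (_+ f (suc n)) (∑-sucˡ n f) ⟩
  f 0 + ∑[ i < n ] f (suc i) + f (suc n) ≡⟨ +-assoc (f 0) _ _ ⟩
  f 0 + ∑[ i < suc n ] f (suc i)         ∎

∑-rotate : ∀ n f → f n ≡ f 0 → ∑[ i < n ] f (suc i) ≡ ∑ n f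
∑-rotate n f fn≡f0 = +-cancelˡ-≡ (f 0) _ _ (begin
  f 0 + ∑[ i < n ] f (suc i) ≡⟨ ∑-sucˡ n f ⟨
  ∑ n f + f n                ≡⟨ cong (∑ n f +_) fn≡f0 ⟩
  ∑ n f + f 0                ≡⟨ +-comm (∑ n f) (f 0) ⟩
  f 0 + ∑ n f                ∎)

∑-+ : ∀ a b f → ∑ (a + b) f ≡ ∑ a f + ∑[ i < b ] f (a + i)
∑-+ a zero    f rewrite +-identityʳ a = sym (+-identityʳ (∑ a f))
∑-+ a (suc b) f rewrite +-suc a b | ∑-+ a b f = +-assoc (∑ a f) _ _

∑-* : ∀ p m f → ∑ (p * m) f ≡ ∑[ t < p ] ∑[ r < m ] f (t * m + r)
∑-* zero    m f = refl
∑-* (suc p) m f rewrite +-comm m (p * m) | ∑-+ (p * m) m f | ∑-* p m f = refl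

∑-distrib-+ : ∀ n f g → ∑[ i < n ] (f i + g i) ≡ ∑ n f + ∑ n g
∑-distrib-+ zero    f g = refl
∑-distrib-+ (suc n) f g rewrite ∑-distrib-+ n f g = interchange (∑ n f) (∑ n g) (f n) (g n)

∑-swap : ∀ p m (f : ℕ → ℕ → ℕ) → ∑[ t < p ] ∑[ r < m ] f t r ≡ ∑[ r < m ] ∑[ t < p ] f t r
∑-swap zero    m f = sym (trans (∑-const m 0) (*-zeroʳ m))
∑-swap (suc p) m f rewrite ∑-swap p m f = sym (∑-distrib-+ m (λ r → ∑[ t < p ] f t r) (f p))

∑-*ˡ : ∀ n c f → ∑[ i < n ] (c * f i) ≡ c * ∑ n f
∑-*ˡ zero    c f = sym (*-zeroʳ c)
∑-*ˡ (suc n) c f rewrite ∑-*ˡ n c f = sym (*-distribˡ-+ c (∑ n f) (f n))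

∑-*ʳ : ∀ n c f → ∑[ i < n ] (f i * c) ≡ ∑ n f * c
∑-*ʳ zero    c f = refl
∑-*ʳ (suc n) c f rewrite ∑-*ʳ n c f = sym (*-distribʳ-+ c (∑ n f) (f n))

∑-single : ∀ n f {i₀} → i₀ < n → (∀ {i} → i < n → i ≢ i₀ → f i ≡ 0) → ∑ n f ≡ f i₀
∑-single (suc n) f {i₀} i₀<1+n others with n ≟ i₀
... | yes refl = cong (_+ f n) (begin
  ∑ n f          ≡⟨ ∑-cong n (λ i<n → others (m<n⇒m<1+n i<n) (<⇒≢ i<n)) ⟩
  ∑[ i < n ] 0   ≡⟨ ∑-const n 0 ⟩
  n * 0          ≡⟨ *-zeroʳ n ⟩
  0              ∎)
... | no n≢i₀ = begin
  ∑ n f + f n    ≡⟨ cong₂ _+_ (∑-single n f i₀<n (others ∘ m<n⇒m<1+n)) (others ≤-refl n≢i₀) ⟩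
  f i₀ + 0       ≡⟨ +-identityʳ (f i₀) ⟩
  f i₀           ∎
  where i₀<n = ≤∧≢⇒< (s≤s⁻¹ i₀<1+n) (n≢i₀ ∘ sym)

𝟙 : Bool → ℕ
𝟙 true  = 1
𝟙 false = 0

𝟙-∧ : ∀ a b → 𝟙 (a ∧ b) ≡ 𝟙 a * 𝟙 b
𝟙-∧ true  b = sym (+-identityʳ (𝟙 b))
𝟙-∧ false b = refl

𝟙-does-*-cong : ∀ {ℓ} {P : Set ℓ} (P? : Dec P) {x y} → (P → x ≡ y) → 𝟙 (does P?) * x ≡ 𝟙 (does P?) * y
𝟙-does-*-cong (yes p) x≡y = cong (1 *_) (x≡y p)
𝟙-does-*-cong (no  _) _   = refl

length-filter-applyUpTo : ∀ {ℓ} {P : Pred ℕ ℓ} (P? : Decidable P) f n →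
  length (filter P? (applyUpTo f n)) ≡ ∑[ i < n ] 𝟙 (does (P? (f i)))
length-filter-applyUpTo P? f zero = refl
length-filter-applyUpTo P? f (suc n)
  rewrite ∑-sucˡ n (λ i → 𝟙 (does (P? (f i)))) with P? (f 0)
... | yes _ = cong suc (length-filter-applyUpTo P? (f ∘ suc) n)
... | no  _ = length-filter-applyUpTo P? (f ∘ suc) n

p∤1 : ∀ {p} → Prime p → ¬ p ∣ 1
p∤1 pp p∣1 = ¬prime[1] (subst Prime (∣1⇒≡1 p∣1) pp)

∤⇒coprime : ∀ {p x} → Prime p → ¬ p ∣ x → Coprime x p
∤⇒coprime pp p∤x (d∣x , d∣p) with prime⇒irreducible pp d∣p
... | inj₁ d≡1  = d≡1
... | inj₂ refl = contradiction d∣x p∤x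

coprime-*-prime : ∀ {p x m} → Prime p → Coprime x (p * m) ⇔ (¬ p ∣ x × Coprime x m)
coprime-*-prime {p} {x} {m} pp = mk⇔ split join
  where
  split : Coprime x (p * m) → ¬ p ∣ x × Coprime x m
  split x⊥pm = (λ p∣x → p∤1 pp (subst (p ∣_) (x⊥pm (p∣x , m∣m*n m)) ∣-refl))
             , (λ (d∣x , d∣m) → x⊥pm (d∣x , ∣n⇒∣m*n p d∣m))
  join : ¬ p ∣ x × Coprime x m → Coprime x (p * m)
  join (p∤x , x⊥m) (d∣x , d∣pm) =
    x⊥m (d∣x , coprime-divisor (λ (e∣d , e∣p) → ∤⇒coprime pp p∤x (∣-trans e∣d d∣x , e∣p)) d∣pm)

coprime-periodic : ∀ t a n → Coprime (t * n + a) n ⇔ Coprime a n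
coprime-periodic t a n = mk⇔ drop add
  where
  drop : Coprime (t * n + a) n → Coprime a n
  drop c (d∣a , d∣n) = c (∣m∣n⇒∣m+n (∣n⇒∣m*n t d∣n) d∣a , d∣n)
  add : Coprime a n → Coprime (t * n + a) n
  add c (d∣x , d∣n) = c (∣m+n∣m⇒∣n d∣x (∣n⇒∣m*n t d∣n) , d∣n)

Admissible : ℕ → Pred ℕ _
Admissible n j = Coprime j n × Coprime (suc j) n

admissible? : ∀ n → Decidable (Admissible n)
admissible? n j = coprime? j n ×-dec coprime? (suc j) n

Avoids : ℕ → Pred ℕ _
Avoids p x = ¬ p ∣ x × ¬ p ∣ suc x

avoids? : ∀ p → Decidable (Avoids p)
avoids? p x = ¬? (p ∣? x) ×-dec ¬? (p ∣? suc x)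

admissible-periodic : ∀ t r n → Admissible n (t * n + r) ⇔ Admissible n r
admissible-periodic t r n = mk⇔
  (λ (c₀ , c₁) → to   (coprime-periodic t r n) c₀ , to   (coprime-periodic t (suc r) n) (shift⁻¹ c₁))
  (λ (c₀ , c₁) → from (coprime-periodic t r n) c₀ , shift (from (coprime-periodic t (suc r) n) c₁))
  where
  shift : Coprime (t * n + suc r) n → Coprime (suc (t * n + r)) n
  shift = subst (λ x → Coprime x n) (+-suc (t * n) r)
  shift⁻¹ : Coprime (suc (t * n + r)) n → Coprime (t * n + suc r) n
  shift⁻¹ = subst (λ x → Coprime x n) (sym (+-suc (t * n) r))

admissible-*-prime : ∀ {p} → Prime p → ∀ m x → Admissible (p * m) x ⇔ (Admissible m x × Avoids p x)
admissible-*-prime pp m x = mk⇔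
  (λ (c₀ , c₁) → let (p∤x , c₀′) = to (coprime-*-prime pp) c₀; (p∤1+x , c₁′) = to (coprime-*-prime pp) c₁
                 in (c₀′ , c₁′) , (p∤x , p∤1+x))
  (λ ((c₀ , c₁) , (p∤x , p∤1+x)) → from (coprime-*-prime pp) (p∤x , c₀) , from (coprime-*-prime pp) (p∤1+x , c₁))

L₂≡∑ : ∀ n → L₂ n ≡ ∑[ j < n ] 𝟙 (does (admissible? n j))
L₂≡∑ n = begin
  L₂ n                                            ≡⟨ cong (length ∘ filter (admissible? n)) (map-upTo suc n) ⟩
  length (filter (admissible? n) (applyUpTo suc n)) ≡⟨ length-filter-applyUpTo (admissible? n) suc n ⟩
  ∑[ j < n ] 𝟙 (does (admissible? n (suc j)))     ≡⟨ ∑-rotate n (λ j → 𝟙 (does (admissible? n j))) (cong 𝟙 n~0) ⟩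
  ∑[ j < n ] 𝟙 (does (admissible? n j))           ∎
  where
  n~0 : does (admissible? n n) ≡ does (admissible? n 0)
  n~0 = trans (cong (does ∘ admissible? n) (sym (trans (+-identityʳ (1 * n)) (*-identityˡ n))))
              (does-⇔ (admissible-periodic 1 0 n) (admissible? n (1 * n + 0)) (admissible? n 0))

L₂-*-prime : ∀ {p} → Prime p → ∀ m →
  L₂ (p * m) ≡ ∑[ r < m ] (𝟙 (does (admissible? m r)) * ∑[ t < p ] 𝟙 (does (avoids? p (t * m + r))))
L₂-*-prime {p} pp m = begin
  L₂ (p * m)                                                     ≡⟨ L₂≡∑ (p * m) ⟩
  ∑[ j < p * m ] 𝟙 (does (admissible? (p * m) j))               ≡⟨ ∑-* p m _ ⟩
  ∑[ t < p ] ∑[ r < m ] 𝟙 (does (admissible? (p * m) (t * m + r))) ≡⟨ ∑-cong p (λ {t} _ → ∑-cong m (λ {r} _ → split t r)) ⟩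
  ∑[ t < p ] ∑[ r < m ] (A r * B t r)                           ≡⟨ ∑-swap p m _ ⟩
  ∑[ r < m ] ∑[ t < p ] (A r * B t r)                           ≡⟨ ∑-cong m (λ {r} _ → ∑-*ˡ p (A r) (λ t → B t r)) ⟩
  ∑[ r < m ] (A r * ∑[ t < p ] B t r)                           ∎
  where
  A : ℕ → ℕ
  A r = 𝟙 (does (admissible? m r))
  B : ℕ → ℕ → ℕ
  B t r = 𝟙 (does (avoids? p (t * m + r)))
  split : ∀ t r → 𝟙 (does (admissible? (p * m) (t * m + r))) ≡ A r * B t r
  split t r = begin
    𝟙 (does (admissible? (p * m) x))
      ≡⟨ cong 𝟙 (does-⇔ (admissible-*-prime pp m x) (admissible? (p * m) x) (admissible? m x ×-dec avoids? p x)) ⟩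
    𝟙 (does (admissible? m x) ∧ does (avoids? p x))
      ≡⟨ cong (λ b → 𝟙 (b ∧ does (avoids? p x))) (does-⇔ (admissible-periodic t r m) (admissible? m x) (admissible? m r)) ⟩
    𝟙 (does (admissible? m r) ∧ does (avoids? p x))
      ≡⟨ 𝟙-∧ (does (admissible? m r)) (does (avoids? p x)) ⟩
    A r * B t r
      ∎
    where x = t * m + r

∣∧<⇒≡0 : ∀ {m n} → m ∣ n → n < m → n ≡ 0
∣∧<⇒≡0 {n = zero}  _   _   = refl
∣∧<⇒≡0 {n = suc _} m∣n n<m = contradiction m∣n (>⇒∤ n<m)

solution-gap≡0 : ∀ {p m c t k} → Prime p → ¬ p ∣ m → t + k < p →
  p ∣ t * m + c → p ∣ (t + k) * m + c → k ≡ 0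
solution-gap≡0 {p} {m} {c} {t} {k} pp p∤m t+k<p p∣t p∣t+k
  with euclidsLemma k m pp (∣m+n∣m⇒∣n (subst (p ∣_) (regroup t k m c) p∣t+k) p∣t)
  where
  regroup : ∀ t k m c → (t + k) * m + c ≡ (t * m + c) + k * m
  regroup = solve-∀
... | inj₁ p∣k = ∣∧<⇒≡0 p∣k (≤-<-trans (m≤n+m k t) t+k<p)
... | inj₂ p∣m = contradiction p∣m p∤m

solution-unique : ∀ {p m c t t′} → Prime p → ¬ p ∣ m → t < p → t′ < p →
  p ∣ t * m + c → p ∣ t′ * m + c → t ≡ t′
solution-unique {t = t} {t′} pp p∤m t<p t′<p p∣t p∣t′ with ≤-total t t′
... | inj₁ t≤t′ with k , refl ← m≤n⇒∃[o]m+o≡n t≤t′ =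
  sym (trans (cong (t +_) (solution-gap≡0 pp p∤m t′<p p∣t p∣t′)) (+-identityʳ t))
... | inj₂ t′≤t with k , refl ← m≤n⇒∃[o]m+o≡n t′≤t =
  trans (cong (t′ +_) (solution-gap≡0 pp p∤m t<p p∣t′ p∣t)) (+-identityʳ t′)

-- Bézout gives x with x·m ≡ -1 or x·m ≡ 1 (mod p); then a = x·c, resp. a = x·(p - 1)·c,
-- solves a·m ≡ -c.
solvable : ∀ {p m} .{{_ : NonZero p}} → Coprime m p → ∀ c → ∃[ a ] p ∣ a * m + c
solvable {suc p′} {m} m⊥p c with coprime-Bézout m⊥p
... | Bézout.-+ x y 1+xm≡yp = x * c , divides (c * y) (begin
  x * c * m + c ≡⟨ lhs x c m ⟩
  c * (1 + x * m) ≡⟨ cong (c *_) 1+xm≡yp ⟩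
  c * (y * suc p′) ≡⟨ *-assoc c y (suc p′) ⟨
  c * y * suc p′ ∎)
  where
  lhs : ∀ x c m → x * c * m + c ≡ c * (1 + x * m)
  lhs = solve-∀
... | Bézout.+- x y 1+yp≡xm = x * (p′ * c) , divides (c + p′ * c * y) (begin
  x * (p′ * c) * m + c ≡⟨ lhs x p′ c m ⟩
  p′ * c * (x * m) + c ≡⟨ cong (λ z → p′ * c * z + c) 1+yp≡xm ⟨
  p′ * c * (1 + y * suc p′) + c ≡⟨ rhs p′ c y ⟩
  (c + p′ * c * y) * suc p′ ∎)
  where
  lhs : ∀ x p′ c m → x * (p′ * c) * m + c ≡ p′ * c * (x * m) + c
  lhs = solve-∀
  rhs : ∀ p′ c y → p′ * c * (1 + y * suc p′) + c ≡ (c + p′ * c * y) * suc p′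
  rhs = solve-∀

solvable-mod : ∀ {p m c} .{{_ : NonZero p}} → ∀ a → p ∣ a * m + c → p ∣ (a % p) * m + c
solvable-mod {p} {m} {c} a p∣ = ∣m+n∣m⇒∣n (subst (p ∣_) split p∣) (n∣m*n (a / p * m))
  where
  split : a * m + c ≡ a / p * m * p + (a % p * m + c)
  split = begin
    a * m + c                       ≡⟨ cong (λ z → z * m + c) (m≡m%n+[m/n]*n a p) ⟩
    (a % p + a / p * p) * m + c     ≡⟨ regroup (a % p) (a / p) m c p ⟩
    a / p * m * p + (a % p * m + c) ∎
    where
    regroup : ∀ r q m c p → (r + q * p) * m + c ≡ q * m * p + (r * m + c)
    regroup = solve-∀

solution-exists : ∀ {p m} → Prime p → ¬ p ∣ m → ∀ c → ∃[ t ] t < p × p ∣ t * m + c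
solution-exists {p} pp p∤m c = let a , p∣ = solvable (∤⇒coprime pp p∤m) c in
  a % p , m%n<n a p , solvable-mod a p∣
  where
  instance
    p≢0 : NonZero p
    p≢0 = prime⇒nonZero pp

count-solutions : ∀ {p m} → Prime p → ¬ p ∣ m → ∀ c → ∑[ t < p ] 𝟙 (does (p ∣? t * m + c)) ≡ 1
count-solutions {p} {m} pp p∤m c = let t₀ , t₀<p , p∣t₀ = solution-exists pp p∤m c in begin
  ∑[ t < p ] 𝟙 (does (p ∣? t * m + c)) ≡⟨ ∑-single p _ t₀<p (λ t<p t≢t₀ →
                                            cong 𝟙 (dec-false (p ∣? _) (t≢t₀ ∘ λ p∣t → solution-unique pp p∤m t<p t₀<p p∣t p∣t₀))) ⟩
  𝟙 (does (p ∣? t₀ * m + c))           ≡⟨ cong 𝟙 (dec-true (p ∣? _) p∣t₀) ⟩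
  1                                    ∎

𝟙-avoids+𝟙-∣+𝟙-∣suc : ∀ {p} → Prime p → ∀ x →
  𝟙 (does (avoids? p x)) + (𝟙 (does (p ∣? x)) + 𝟙 (does (p ∣? suc x))) ≡ 1
𝟙-avoids+𝟙-∣+𝟙-∣suc {p} pp x with p ∣? x | p ∣? suc x
... | yes p∣x | yes p∣1+x = contradiction (∣m+n∣m⇒∣n (subst (p ∣_) (+-comm 1 x) p∣1+x) p∣x) (p∤1 pp)
... | yes _   | no  _     = refl
... | no  _   | yes _     = refl
... | no  _   | no  _     = refl

count-avoids : ∀ {p m} → Prime p → ¬ p ∣ m → ∀ r → ∑[ t < p ] 𝟙 (does (avoids? p (t * m + r))) ≡ p ∸ 2
count-avoids {p} {m} pp p∤m r = begin
  N         ≡⟨ m+n∸n≡m N 2 ⟨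
  N + 2 ∸ 2 ≡⟨ cong (_∸ 2) N+2≡p ⟩
  p ∸ 2     ∎
  where
  N = ∑[ t < p ] 𝟙 (does (avoids? p (t * m + r)))
  D₀ = ∑[ t < p ] 𝟙 (does (p ∣? t * m + r))
  D₁ = ∑[ t < p ] 𝟙 (does (p ∣? suc (t * m + r)))
  D₁≡1 : D₁ ≡ 1
  D₁≡1 = trans (∑-cong p (λ {t} _ → cong (𝟙 ∘ does ∘ (p ∣?_)) (sym (+-suc (t * m) r))))
               (count-solutions pp p∤m (suc r))
  N+2≡p : N + 2 ≡ p
  N+2≡p = begin
    N + (1 + 1)   ≡⟨ cong (N +_) (cong₂ _+_ (count-solutions pp p∤m r) D₁≡1) ⟨
    N + (D₀ + D₁) ≡⟨ trans (∑-distrib-+ p _ _) (cong (N +_) (∑-distrib-+ p _ _)) ⟨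
    ∑[ t < p ] (𝟙 (does (avoids? p (t * m + r))) + (𝟙 (does (p ∣? t * m + r)) + 𝟙 (does (p ∣? suc (t * m + r)))))
                  ≡⟨ ∑-cong p (λ {t} _ → 𝟙-avoids+𝟙-∣+𝟙-∣suc pp (t * m + r)) ⟩
    ∑[ t < p ] 1  ≡⟨ ∑-const p 1 ⟩
    p * 1         ≡⟨ *-identityʳ p ⟩
    p             ∎

L₂-*-prime-∤ : ∀ {p m} → Prime p → ¬ p ∣ m → L₂ (p * m) ≡ L₂ m * (p ∸ 2)
L₂-*-prime-∤ {p} {m} pp p∤m = begin
  L₂ (p * m)                                             ≡⟨ L₂-*-prime pp m ⟩
  ∑[ r < m ] (A r * ∑[ t < p ] 𝟙 (does (avoids? p (t * m + r)))) ≡⟨ ∑-cong m (λ {r} _ → cong (A r *_) (count-avoids pp p∤m r)) ⟩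
  ∑[ r < m ] (A r * (p ∸ 2))                             ≡⟨ ∑-*ʳ m (p ∸ 2) A ⟩
  ∑ m A * (p ∸ 2)                                        ≡⟨ cong (_* (p ∸ 2)) (L₂≡∑ m) ⟨
  L₂ m * (p ∸ 2)                                         ∎
  where
  A : ℕ → ℕ
  A r = 𝟙 (does (admissible? m r))

admissible⇒avoids : ∀ {p m r} → Prime p → p ∣ m → Admissible m r → ∀ t → Avoids p (t * m + r)
admissible⇒avoids {p} {m} {r} pp p∣m (r⊥m , 1+r⊥m) t =
    (λ p∣x → p∤1 pp (subst (p ∣_) (r⊥m (below p∣x , p∣m)) ∣-refl))
  , (λ p∣1+x → p∤1 pp (subst (p ∣_) (1+r⊥m (below (subst (p ∣_) (sym (+-suc (t * m) r)) p∣1+x) , p∣m)) ∣-refl))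
  where
  below : ∀ {a} → p ∣ t * m + a → p ∣ a
  below p∣ = ∣m+n∣m⇒∣n p∣ (∣n⇒∣m*n t p∣m)

L₂-*-prime-∣ : ∀ {p m} → Prime p → p ∣ m → L₂ (p * m) ≡ L₂ m * p
L₂-*-prime-∣ {p} {m} pp p∣m = begin
  L₂ (p * m)                                             ≡⟨ L₂-*-prime pp m ⟩
  ∑[ r < m ] (A r * ∑[ t < p ] 𝟙 (does (avoids? p (t * m + r)))) ≡⟨ ∑-cong m (λ {r} _ → unconstrained r) ⟩
  ∑[ r < m ] (A r * p)                                   ≡⟨ ∑-*ʳ m p A ⟩
  ∑ m A * p                                              ≡⟨ cong (_* p) (L₂≡∑ m) ⟨
  L₂ m * p                                               ∎
  where
  A : ℕ → ℕ
  A r = 𝟙 (does (admissible? m r))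
  unconstrained : ∀ r → A r * ∑[ t < p ] 𝟙 (does (avoids? p (t * m + r))) ≡ A r * p
  unconstrained r = 𝟙-does-*-cong (admissible? m r) λ adm → begin
    ∑[ t < p ] 𝟙 (does (avoids? p (t * m + r))) ≡⟨ ∑-cong p (λ {t} _ → cong 𝟙 (dec-true (avoids? p _) (admissible⇒avoids pp p∣m adm t))) ⟩
    ∑[ t < p ] 1                                ≡⟨ ∑-const p 1 ⟩
    p * 1                                       ≡⟨ *-identityʳ p ⟩
    p                                           ∎

p∣n⇒p∸2∣L₂n : ∀ {p n} → Prime p → p ∣ n → p ∸ 2 ∣ L₂ n
p∣n⇒p∸2∣L₂n {p} {n} pp = <-rec (λ n → p ∣ n → p ∸ 2 ∣ L₂ n) step n
  where
  step : ∀ n → (∀ {m} → m < n → p ∣ m → p ∸ 2 ∣ L₂ m) → p ∣ n → p ∸ 2 ∣ L₂ n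
  step zero      _  _   = (p ∸ 2) ∣0
  step n@(suc _) ih p∣n = subst (λ x → p ∸ 2 ∣ L₂ x) (sym n≡pm) (by-cases (p ∣? m))
    where
    m = quotient p∣n
    n≡pm : n ≡ p * m
    n≡pm = m∣n⇒n≡m*quotient p∣n
    by-cases : Dec (p ∣ m) → p ∸ 2 ∣ L₂ (p * m)
    by-cases (yes p∣m) = subst (p ∸ 2 ∣_) (sym (L₂-*-prime-∣ pp p∣m)) (∣m⇒∣m*n p (ih (quotient-< p∣n) p∣m))
    by-cases (no  p∤m) = subst (p ∸ 2 ∣_) (sym (L₂-*-prime-∤ pp p∤m)) (n∣m*n (L₂ m))

prime-factor : ∀ {n} → 1 < n → ∃[ p ] Prime p × p ∣ n
prime-factor {1} (s≤s ())
prime-factor {n@(suc (suc _))} _ with factorise n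
... | record { factors = [] ; isFactorisation = () }
... | record { factors = p ∷ ps ; isFactorisation = n≡p*ps ; factorsPrime = pp ∷ _ } =
  p , pp , subst (p ∣_) (sym n≡p*ps) (m∣m*n (product ps))

residue-mod-3 : ∀ a → a % 3 ≡ 0 ⊎ a % 3 ≡ 1 ⊎ a % 3 ≡ 2
residue-mod-3 a with a % 3 | m%n<n a 3
... | 0 | _ = inj₁ refl
... | 1 | _ = inj₂ (inj₁ refl)
... | 2 | _ = inj₂ (inj₂ refl)
... | suc (suc (suc _)) | s≤s (s≤s (s≤s ()))

prime%3≡0⇒≡3 : ∀ {p} → Prime p → p % 3 ≡ 0 → p ≡ 3
prime%3≡0⇒≡3 {p} pp p%3≡0 with prime⇒irreducible pp (m%n≡0⇒n∣m p 3 p%3≡0)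
... | inj₂ 3≡p = sym 3≡p

n%3≡2⇒3∣n∸2 : ∀ n → n % 3 ≡ 2 → 3 ∣ n ∸ 2
n%3≡2⇒3∣n∸2 n n%3≡2 = divides (n / 3) (cong (_∸ 2) (begin
  n                  ≡⟨ m≡m%n+[m/n]*n n 3 ⟩
  n % 3 + n / 3 * 3  ≡⟨ cong (_+ n / 3 * 3) n%3≡2 ⟩
  2 + n / 3 * 3      ∎))

n%3≡1⇒[n∸2]%3≡2 : ∀ {n} → 1 < n → n % 3 ≡ 1 → (n ∸ 2) % 3 ≡ 2
n%3≡1⇒[n∸2]%3≡2 {n} 1<n n%3≡1 with n / 3 | m≡m%n+[m/n]*n n 3
... | zero  | n≡n%3 = contradiction (trans n≡n%3 (trans (+-identityʳ (n % 3)) n%3≡1)) (>⇒≢ 1<n)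
... | suc q | n≡n%3+[1+q]*3 = begin
  (n ∸ 2) % 3                  ≡⟨ cong (λ x → (x ∸ 2) % 3) (trans n≡n%3+[1+q]*3 (cong (_+ suc q * 3) n%3≡1)) ⟩
  (1 + suc q * 3 ∸ 2) % 3      ≡⟨ [m+kn]%n≡m%n 2 q 3 ⟩
  2                            ∎

prime-factor-≡2-mod-3 : ∀ n → n % 3 ≡ 2 → ∃[ q ] Prime q × q ∣ n × q % 3 ≡ 2
prime-factor-≡2-mod-3 = <-rec (λ n → n % 3 ≡ 2 → ∃[ q ] Prime q × q ∣ n × q % 3 ≡ 2) step
  where
  step : ∀ n → (∀ {m} → m < n → m % 3 ≡ 2 → ∃[ q ] Prime q × q ∣ m × q % 3 ≡ 2) →
         n % 3 ≡ 2 → ∃[ q ] Prime q × q ∣ n × q % 3 ≡ 2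
  step n@(suc (suc _)) ih n%3≡2 with prime-factor {n} (s≤s (s≤s z≤n))
  ... | p , pp@(prime _) , p∣n with residue-mod-3 p
  ...   | inj₁ p%3≡0 =
    contradiction (trans (sym (n∣m⇒m%n≡0 n 3 (subst (_∣ n) (prime%3≡0⇒≡3 pp p%3≡0) p∣n))) n%3≡2) λ ()
  ...   | inj₂ (inj₂ p%3≡2) = p , pp , p∣n , p%3≡2
  ...   | inj₂ (inj₁ p%3≡1) =
    let q , qp , q∣m , q%3≡2 = ih (quotient-< p∣n) m%3≡2
    in  q , qp , subst (q ∣_) (sym n≡pm) (∣n⇒∣m*n p q∣m) , q%3≡2
    where
    m = quotient p∣n
    n≡pm : n ≡ p * m
    n≡pm = m∣n⇒n≡m*quotient p∣n
    m%3≡2 : m % 3 ≡ 2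
    m%3≡2 = begin
      m % 3                   ≡⟨ m%n%n≡m%n m 3 ⟨
      m % 3 % 3               ≡⟨ cong (_% 3) (*-identityˡ (m % 3)) ⟨
      1 * (m % 3) % 3         ≡⟨ cong (λ z → z * (m % 3) % 3) p%3≡1 ⟨
      (p % 3) * (m % 3) % 3   ≡⟨ %-distribˡ-* p m 3 ⟨
      p * m % 3               ≡⟨ cong (_% 3) n≡pm ⟨
      n % 3                   ≡⟨ n%3≡2 ⟩
      2                       ∎

prime≢3-cases : ∀ {p} → Prime p → p ≢ 3 → 3 ∣ p ∸ 2 ⊎ ∃[ q ] Prime q × q ∣ p ∸ 2 × 3 ∣ q ∸ 2
prime≢3-cases {p} pp@(prime _) p≢3 with residue-mod-3 p
... | inj₁ p%3≡0        = contradiction (prime%3≡0⇒≡3 pp p%3≡0) p≢3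
... | inj₂ (inj₂ p%3≡2) = inj₁ (n%3≡2⇒3∣n∸2 p p%3≡2)
... | inj₂ (inj₁ p%3≡1) =
  let q , qp , q∣p∸2 , q%3≡2 = prime-factor-≡2-mod-3 (p ∸ 2) (n%3≡1⇒[n∸2]%3≡2 (nonTrivial⇒n>1 p) p%3≡1)
  in  inj₂ (q , qp , q∣p∸2 , n%3≡2⇒3∣n∸2 q q%3≡2)

lemma2p1 : (k : ℕ) → 1 < k → ¬ (2 ∣ k) →
    (3 ∣ k) ⊎ (3 ∣ L₂ k) ⊎ (3 ∣ L₂² k)
lemma2p1 k 1<k _ = case 3 ∣? k of λ where
  (yes 3∣k) → inj₁ 3∣k
  (no  3∤k) →
    let p , pp , p∣k = prime-factor 1<k
        p∸2∣L₂k = p∣n⇒p∸2∣L₂n pp p∣k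
    in  inj₂ (Sum.map (λ 3∣p∸2 → ∣-trans 3∣p∸2 p∸2∣L₂k)
                      (λ (q , qp , q∣p∸2 , 3∣q∸2) → ∣-trans 3∣q∸2 (p∣n⇒p∸2∣L₂n qp (∣-trans q∣p∸2 p∸2∣L₂k)))
                      (prime≢3-cases pp λ p≡3 → 3∤k (subst (_∣ k) p≡3 p∣k)))
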